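{- For positive integers $n$: (i) a $2$-divisible set of points over $\mathbb{F}_2$ of cardinality $n$ exists for all $n\ge 3$ and does not exist for $n\in\{1,2\}$; in particular $\mathrm{F}(2,1)=2$. (ii) A $4$-divisible set of points over $\mathbb{F}_2$ of cardinality $n$ exists if and only if $n\in\{7,8\}$ or $n\ge 14$; in particular $\mathrm{F}(2,2)=13$. (iii) An $8$-divisible set of points over $\mathbb{F}_2$ of cardinality $n$ exists for $n\in\{15,16,30,31,32,45,46,47,48,49,50,51\}$ and for all $n\ge 60$, and does not exist for every other positive $n$ except possibly $n=59$; thus $\mathrm{F}(2,3)\in\{58,59\}$.
   Context: A set of points over $\mathbb{F}_q$ means a set of $1$-dimensional subspaces of $\mathbb{F}_q^v$ for some $v\ge1$; hyperplanes are the $(v-1)$-dimensional subspaces. For an integer $\Delta>1$, such a set $\mathcal{C}$ is $\Delta$-divisible if $|\mathcal{C}\cap H|\equiv|\mathcal{C}|\pmod\Delta$ for every hyperplane $H$, where $\mathcal{C}\cap H$ is the set of points of $\mathcal{C}$ contained in $H$ (this property does not depend on the choice of ambient $v$ containing the span of $\mathcal{C}$). $\mathrm{F}(q,r)$ denotes the smallest positive integer such that a $q^r$-divisible set of points over $\mathbb{F}_q$ of cardinality $n$ exists for every integer $n>\mathrm{F}(q,r)$. -}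

module Defs where

open import Data.Bool using (Bool; true; false; _∧_; _xor_)
open import Data.Nat using (ℕ; zero; suc; _+_; _^_; _<_; _≤_; _%_)
open import Data.Vec using (Vec; []; _∷_; replicate)
open import Data.List using (List; []; _∷_; length)
open import Data.List.Relation.Unary.All using (All)
open import Data.List.Relation.Unary.Unique.Propositional using (Unique)
open import Data.Product using (Σ; _×_)
open import Relation.Binary.PropositionalEquality using (_≡_; _≢_)
open import Relation.Nullary using (¬_)

-- Vectors of F_2^v, with F_2 = Bool (false = 0, true = 1, xor = +, ∧ = ·).
F₂^ : ℕ → Set
F₂^ v = Vec Bool v

zeroVec : (v : ℕ) → F₂^ v
zeroVec v = replicate v false

dot : {v : ℕ} → F₂^ v → F₂^ v → Bool
dot [] [] = false
dot (a ∷ as) (x ∷ xs) = (a ∧ x) xor dot as xs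

-- Over F_2 a 1-dimensional subspace <x> is determined by its unique nonzero
-- vector x.  A point of PG(v-1,2) is thus a nonzero vector.
IsPoint : {v : ℕ} → F₂^ v → Set
IsPoint {v} x = x ≢ zeroVec v

IsPointSet : {v : ℕ} → List (F₂^ v) → Set
IsPointSet C = Unique C × All IsPoint C

-- Every hyperplane of F_2^v is the kernel H_a = { x | a · x = 0 } of a
-- nonzero linear functional a (and conversely).  |C ∩ H_a|:
countIn : {v : ℕ} → F₂^ v → List (F₂^ v) → ℕ
countIn a [] = 0
countIn a (x ∷ xs) with dot a x
... | false = suc (countIn a xs)
... | true  = countIn a xs

Divisible : {v : ℕ} → (Δ : ℕ) → .{{_ : Data.Nat.NonZero Δ}} → List (F₂^ v) → Set
Divisible {v} Δ C = (a : F₂^ v) → a ≢ zeroVec v → countIn a C % Δ ≡ length C % Δ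

ExistsDivSet : (r n : ℕ) → Set
ExistsDivSet r n =
  Σ ℕ λ w → Σ (List (F₂^ (suc w))) λ C →
    IsPointSet C × Divisible (2 ^ r) {{Data.Nat.Properties.m^n≢0 2 r}} C × length C ≡ n
  where import Data.Nat.Properties

-- m = F(2,r): m is the smallest positive integer such that a 2^r-divisible set
-- of cardinality n exists for every n > m.
IsF2 : (r m : ℕ) → Set
IsF2 r m =
  1 ≤ m
  × ((n : ℕ) → m < n → ExistsDivSet r n)
  × ((k : ℕ) → 1 ≤ k → k < m → ¬ ((n : ℕ) → k < n → ExistsDivSet r n))

-- Existence: the listed sets are verified by evaluation, and the direct sum of a Δ-divisible
-- set of size p with one of size n is Δ-divisible of size p + n; so p consecutive realised
-- sizes t, …, t + p − 1 together with a set of size p give every size from t on.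
--
-- Nonexistence: write w_b = |D ∖ b⊥| for a set D of n points of F₂^v and b ∈ F₂^v.  The
-- standard equations give ∑_b w_b and ∑_b w_b² exactly and bound ∑_b w_b³ from above.  If
-- Δ divides every w_b, then (w_b − kΔ)(w_b − (k + 1)Δ) ≥ 0 for every k; summing this and
-- w_b times it over b gives two inequalities in Δ, n and k, which fail for every excluded
-- size except n = 33 with Δ = 8.  There some hyperplane misses at least 24 of the points, by
-- averaging, so it contains 9 or 1 of them, and those form a 4-divisible set: excluded again.

{-# OPTIONS --safe #-}
module Submission where

open import Defs
open import Data.Nat using (ℕ; _≤_; _<_)
open import Data.Product using (_×_)
open import Data.Sum using (_⊎_)
open import Relation.Binary.PropositionalEquality using (_≡_; _≢_)
open import Relation.Nullary using (¬_)

open import Algebra.Bundles using (CommutativeRing)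
open import Data.Bool as Bool using (Bool; true; false; not; _∧_; _xor_)
open import Data.Bool.Properties
  using (∧-distribˡ-xor; ∧-distribʳ-xor; ∧-zeroʳ; xor-assoc; xor-identityʳ; xor-∧-commutativeRing)
open import Data.Empty using (⊥; ⊥-elim)
open import Data.Fin using (Fin; toℕ; fromℕ<)
open import Data.Fin.Properties using (any?; all?; toℕ-fromℕ<)
open import Data.List using (List; []; _∷_; length; map; filter; upTo; _++_)
open import Data.List.Membership.Propositional using (_∈_)
open import Data.List.Membership.Propositional.Properties using (∈-map⁻; ∈-upTo⁺)
open import Data.List.Properties using (length-map; length-++; map-++)
open import Data.List.Relation.Unary.All as All using (All; []; _∷_)
import Data.List.Relation.Unary.All.Properties as Allₚ
open import Data.List.Relation.Unary.AllPairs using ([]; _∷_)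
open import Data.List.Relation.Unary.Unique.Propositional using (Unique)
import Data.List.Relation.Unary.Unique.DecPropositional as UniqueDec
import Data.List.Relation.Unary.Unique.Propositional.Properties as Uniqueₚ
open import Data.Nat
  using (zero; suc; _+_; _*_; _^_; _∸_; _%_; _/_; _≡ᵇ_; _≟_; _≤?_; _<?_; z≤n; s≤s; NonZero)
open import Data.Nat.DivMod using (m≡m%n+[m/n]*n; [m+kn]%n≡m%n; m%n<n)
open import Data.Nat.Divisibility
  using (_∣_; _∣?_; divides; ∣m∣n⇒∣m+n; ∣m+n∣m⇒∣n; n∣m*n; *-cancelˡ-∣)
open import Data.Nat.ListAction using (sum)
open import Data.Nat.ListAction.Properties using (sum-++)
open import Data.Nat.Properties
open import Data.Nat.Tactic.RingSolver using (solve-∀)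
open import Data.Product using (∃; _,_)
open import Data.Sum using (inj₁; inj₂)
open import Data.Vec using ([]; _∷_; zipWith; splitAt) renaming (_++_ to _++ᵛ_)
open import Data.Vec.Properties using (∷-injectiveʳ; ++-injectiveˡ; ++-injectiveʳ; ≡-dec)
open import Function using (_∘_; _⇔_; mk⇔; Equivalence)
open import Relation.Binary.Definitions using (DecidableEquality)
open import Relation.Binary.PropositionalEquality
  using (refl; sym; trans; cong; cong₂; subst; ≢-sym; module ≡-Reasoning)
open import Relation.Nullary using (Dec; yes; no; ¬?)
open import Relation.Nullary.Decidable using (True; toWitness; map′; _×-dec_; _⊎-dec_)

open import Algebra.Properties.CommutativeSemigroup
  (CommutativeRing.+-commutativeSemigroup xor-∧-commutativeRing) using () renaming (interchange to xor-interchange)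
open import Algebra.Properties.CommutativeSemigroup
  +-commutativeSemigroup using () renaming (interchange to +-interchange)

-- Linear algebra over F₂

infixl 6 _⊕_
infix 4 _≟ᵛ_

_≟ᵛ_ : ∀ {v} → DecidableEquality (F₂^ v)
_≟ᵛ_ = ≡-dec Bool._≟_

_⊕_ : {v : ℕ} → F₂^ v → F₂^ v → F₂^ v
_⊕_ = zipWith _xor_

dot-⊕ʳ : ∀ {v} (b x y : F₂^ v) → dot b (x ⊕ y) ≡ dot b x xor dot b y
dot-⊕ʳ [] [] [] = refl
dot-⊕ʳ (b₀ ∷ b) (x₀ ∷ x) (y₀ ∷ y) =
  trans (cong₂ _xor_ (∧-distribˡ-xor b₀ x₀ y₀) (dot-⊕ʳ b x y))
        (xor-interchange (b₀ ∧ x₀) (b₀ ∧ y₀) (dot b x) (dot b y))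

dot-⊕ˡ : ∀ {v} (b c x : F₂^ v) → dot (b ⊕ c) x ≡ dot b x xor dot c x
dot-⊕ˡ [] [] [] = refl
dot-⊕ˡ (b₀ ∷ b) (c₀ ∷ c) (x₀ ∷ x) =
  trans (cong₂ _xor_ (∧-distribʳ-xor x₀ b₀ c₀) (dot-⊕ˡ b c x))
        (xor-interchange (b₀ ∧ x₀) (c₀ ∧ x₀) (dot b x) (dot c x))

dot-zeroʳ : ∀ {v} (b : F₂^ v) → dot b (zeroVec v) ≡ false
dot-zeroʳ [] = refl
dot-zeroʳ (b₀ ∷ b) rewrite ∧-zeroʳ b₀ = dot-zeroʳ b

dot-zeroˡ : ∀ {v} (x : F₂^ v) → dot (zeroVec v) x ≡ false
dot-zeroˡ [] = refl
dot-zeroˡ (_ ∷ x) = dot-zeroˡ x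

⊕≡0⇒≡ : ∀ {v} (x y : F₂^ v) → x ⊕ y ≡ zeroVec v → x ≡ y
⊕≡0⇒≡ [] [] _ = refl
⊕≡0⇒≡ (false ∷ x) (false ∷ y) eq = cong (false ∷_) (⊕≡0⇒≡ x y (∷-injectiveʳ eq))
⊕≡0⇒≡ (true ∷ x) (true ∷ y) eq = cong (true ∷_) (⊕≡0⇒≡ x y (∷-injectiveʳ eq))
⊕≡0⇒≡ (false ∷ x) (true ∷ y) ()
⊕≡0⇒≡ (true ∷ x) (false ∷ y) ()

≢⇒⊕≢0 : ∀ {v} {x y : F₂^ v} → x ≢ y → x ⊕ y ≢ zeroVec v
≢⇒⊕≢0 {x = x} {y} x≢y eq = x≢y (⊕≡0⇒≡ x y eq)

-- Sums over F₂^v and the standard equations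

m+m≡2*m : ∀ m → m + m ≡ 2 * m
m+m≡2*m = solve-∀

∑ : (v : ℕ) → (F₂^ v → ℕ) → ℕ
∑ zero f = f []
∑ (suc v) f = ∑ v (λ b → f (false ∷ b)) + ∑ v (λ b → f (true ∷ b))

∑-cong : ∀ v {f g : F₂^ v → ℕ} → (∀ b → f b ≡ g b) → ∑ v f ≡ ∑ v g
∑-cong zero f≗g = f≗g []
∑-cong (suc v) f≗g = cong₂ _+_ (∑-cong v (λ b → f≗g (false ∷ b))) (∑-cong v (λ b → f≗g (true ∷ b)))

∑-mono : ∀ v {f g : F₂^ v → ℕ} → (∀ b → f b ≤ g b) → ∑ v f ≤ ∑ v g
∑-mono zero f≤g = f≤g []
∑-mono (suc v) f≤g = +-mono-≤ (∑-mono v (λ b → f≤g (false ∷ b))) (∑-mono v (λ b → f≤g (true ∷ b)))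

∑-+ : ∀ v (f g : F₂^ v → ℕ) → ∑ v (λ b → f b + g b) ≡ ∑ v f + ∑ v g
∑-+ zero f g = refl
∑-+ (suc v) f g =
  trans (cong₂ _+_ (∑-+ v f₀ g₀) (∑-+ v f₁ g₁))
        (+-interchange (∑ v f₀) (∑ v g₀) (∑ v f₁) (∑ v g₁))
  where
  f₀ f₁ g₀ g₁ : F₂^ v → ℕ
  f₀ b = f (false ∷ b)
  f₁ b = f (true ∷ b)
  g₀ b = g (false ∷ b)
  g₁ b = g (true ∷ b)

∑-* : ∀ v c (f : F₂^ v → ℕ) → ∑ v (λ b → c * f b) ≡ c * ∑ v f
∑-* zero c f = refl
∑-* (suc v) c f = trans (cong₂ _+_ (∑-* v c _) (∑-* v c _)) (sym (*-distribˡ-+ c _ _))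

∑-const : ∀ v c → ∑ v (λ _ → c) ≡ 2 ^ v * c
∑-const zero c = sym (+-identityʳ c)
∑-const (suc v) c =
  trans (cong₂ _+_ (∑-const v c) (∑-const v c)) (trans (m+m≡2*m (2 ^ v * c)) (sym (*-assoc 2 (2 ^ v) c)))

∑-zero : ∀ v → ∑ v (λ _ → 0) ≡ 0
∑-zero v = trans (∑-const v 0) (*-zeroʳ (2 ^ v))

∑-+₃ : ∀ v (f g h : F₂^ v → ℕ) → ∑ v (λ b → f b + g b + h b) ≡ ∑ v f + ∑ v g + ∑ v h
∑-+₃ v f g h = trans (∑-+ v _ h) (cong (_+ ∑ v h) (∑-+ v f g))

∑-+₄ : ∀ v (f g h k : F₂^ v → ℕ) →
       ∑ v (λ b → f b + g b + h b + k b) ≡ ∑ v f + ∑ v g + ∑ v h + ∑ v k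
∑-+₄ v f g h k = trans (∑-+ v _ k) (cong (_+ ∑ v k) (∑-+₃ v f g h))

∑-scaled-+ : ∀ v c (f g : F₂^ v → ℕ) → c * ∑ v (λ b → f b + g b) ≡ c * ∑ v f + c * ∑ v g
∑-scaled-+ v c f g = trans (cong (c *_) (∑-+ v f g)) (*-distribˡ-+ c (∑ v f) (∑ v g))

∑>⇒∃> : ∀ v (f : F₂^ v → ℕ) c → 2 ^ v * c < ∑ v f → ∃ λ b → c < f b
∑>⇒∃> zero f c lt = [] , subst (_< f []) (+-identityʳ c) lt
∑>⇒∃> (suc v) f c lt with 2 ^ v * c <? ∑ v (λ b → f (false ∷ b))
... | yes lt₀ = let b , c<f = ∑>⇒∃> v _ c lt₀ in false ∷ b , c<f
... | no ≮₀ = let b , c<f = ∑>⇒∃> v f₁ c lt₁ in true ∷ b , c<f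
  where
  open ≤-Reasoning
  f₁ : F₂^ v → ℕ
  f₁ = λ b → f (true ∷ b)
  lt₁ : 2 ^ v * c < ∑ v f₁
  lt₁ = +-cancelˡ-< (2 ^ v * c) _ _ (begin-strict
    2 ^ v * c + 2 ^ v * c          ≡⟨ m+m≡2*m (2 ^ v * c) ⟩
    2 * (2 ^ v * c)                ≡⟨ *-assoc 2 (2 ^ v) c ⟨
    2 ^ suc v * c                  <⟨ lt ⟩
    ∑ v (λ b → f (false ∷ b)) + ∑ v f₁ ≤⟨ +-monoˡ-≤ (∑ v f₁) (≮⇒≥ ≮₀) ⟩
    2 ^ v * c + ∑ v f₁             ∎)

𝟙 : Bool → ℕ
𝟙 true = 1
𝟙 false = 0

χ : {v : ℕ} → F₂^ v → F₂^ v → ℕ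
χ x b = 𝟙 (dot b x)

-- wt b D = |D ∖ b⊥|, the Hamming weight of the codeword (b · x)_{x ∈ D}.
wt : {v : ℕ} → F₂^ v → List (F₂^ v) → ℕ
wt b D = sum (map (λ x → χ x b) D)

𝟙-not : ∀ c → 𝟙 c + 𝟙 (not c) ≡ 1
𝟙-not true = refl
𝟙-not false = refl

𝟙-xor₂ : ∀ c d → 2 * (𝟙 c * 𝟙 d) + 𝟙 (c xor d) ≡ 𝟙 c + 𝟙 d
𝟙-xor₂ false false = refl
𝟙-xor₂ false true = refl
𝟙-xor₂ true false = refl
𝟙-xor₂ true true = refl

𝟙-xor₃ : ∀ c d e → 4 * (𝟙 c * 𝟙 d * 𝟙 e) + 𝟙 (c xor d) + 𝟙 (c xor e) + 𝟙 (d xor e)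
                   ≡ 𝟙 c + 𝟙 d + 𝟙 e + 𝟙 ((c xor d) xor e)
𝟙-xor₃ false false false = refl
𝟙-xor₃ false false true = refl
𝟙-xor₃ false true false = refl
𝟙-xor₃ false true true = refl
𝟙-xor₃ true false false = refl
𝟙-xor₃ true false true = refl
𝟙-xor₃ true true false = refl
𝟙-xor₃ true true true = refl

χ-sum : ∀ v (x : F₂^ v) → IsPoint x → 2 * ∑ v (χ x) ≡ 2 ^ v
χ-sum zero [] x≢0 = ⊥-elim (x≢0 refl)
χ-sum (suc v) (true ∷ x) _ = cong (2 *_) (begin
  ∑ v (χ x) + ∑ v (λ b → 𝟙 (not (dot b x))) ≡⟨ ∑-+ v (χ x) _ ⟨
  ∑ v (λ b → χ x b + 𝟙 (not (dot b x)))     ≡⟨ ∑-cong v (λ b → 𝟙-not (dot b x)) ⟩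
  ∑ v (λ _ → 1)                             ≡⟨ ∑-const v 1 ⟩
  2 ^ v * 1                                 ≡⟨ *-identityʳ (2 ^ v) ⟩
  2 ^ v                                     ∎)
  where open ≡-Reasoning
χ-sum (suc v) (false ∷ x) x≢0 = begin
  2 * (∑ v (χ x) + ∑ v (χ x)) ≡⟨ cong (2 *_) (m+m≡2*m (∑ v (χ x))) ⟩
  2 * (2 * ∑ v (χ x))         ≡⟨ cong (2 *_) (χ-sum v x (x≢0 ∘ cong (false ∷_))) ⟩
  2 * 2 ^ v                   ∎
  where open ≡-Reasoning

χ-sum-≤ : ∀ v (x : F₂^ v) → 2 * ∑ v (χ x) ≤ 2 ^ v
χ-sum-≤ v x with x ≟ᵛ zeroVec v
... | no x≢0 = ≤-reflexive (χ-sum v x x≢0)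
... | yes refl rewrite ∑-cong v (λ b → cong 𝟙 (dot-zeroʳ b)) | ∑-zero v = z≤n

χ-pair-identity : ∀ v (x y : F₂^ v) →
                  2 * ∑ v (λ b → χ x b * χ y b) + ∑ v (χ (x ⊕ y)) ≡ ∑ v (χ x) + ∑ v (χ y)
χ-pair-identity v x y = begin
  2 * ∑ v (λ b → χ x b * χ y b) + ∑ v (χ (x ⊕ y))   ≡⟨ cong (_+ ∑ v (χ (x ⊕ y))) (∑-* v 2 _) ⟨
  ∑ v (λ b → 2 * (χ x b * χ y b)) + ∑ v (χ (x ⊕ y)) ≡⟨ ∑-+ v _ _ ⟨
  ∑ v (λ b → 2 * (χ x b * χ y b) + χ (x ⊕ y) b)     ≡⟨ ∑-cong v pointwise ⟩
  ∑ v (λ b → χ x b + χ y b)                         ≡⟨ ∑-+ v (χ x) (χ y) ⟩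
  ∑ v (χ x) + ∑ v (χ y)                             ∎
  where
  open ≡-Reasoning
  pointwise : ∀ b → 2 * (χ x b * χ y b) + χ (x ⊕ y) b ≡ χ x b + χ y b
  pointwise b rewrite dot-⊕ʳ b x y = 𝟙-xor₂ (dot b x) (dot b y)

χ-pair-sum : ∀ v (x y : F₂^ v) → IsPoint x → IsPoint y → x ≢ y →
             4 * ∑ v (λ b → χ x b * χ y b) ≡ 2 ^ v
χ-pair-sum v x y x≢0 y≢0 x≢y = +-cancelʳ-≡ (2 ^ v) (4 * T) (2 ^ v) (begin
  4 * T + 2 ^ v               ≡⟨ cong (4 * T +_) (χ-sum v (x ⊕ y) (≢⇒⊕≢0 x≢y)) ⟨
  4 * T + 2 * Sxy             ≡⟨ regroup T Sxy ⟩
  2 * (2 * T + Sxy)           ≡⟨ cong (2 *_) (χ-pair-identity v x y) ⟩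
  2 * (Sx + Sy)               ≡⟨ *-distribˡ-+ 2 Sx Sy ⟩
  2 * Sx + 2 * Sy             ≡⟨ cong₂ _+_ (χ-sum v x x≢0) (χ-sum v y y≢0) ⟩
  2 ^ v + 2 ^ v               ∎)
  where
  open ≡-Reasoning
  T Sxy Sx Sy : ℕ
  T = ∑ v (λ b → χ x b * χ y b)
  Sxy = ∑ v (χ (x ⊕ y))
  Sx = ∑ v (χ x)
  Sy = ∑ v (χ y)
  regroup : ∀ t s → 4 * t + 2 * s ≡ 2 * (2 * t + s)
  regroup = solve-∀

χ-triple-identity : ∀ v (x y z : F₂^ v) →
  4 * ∑ v (λ b → χ x b * χ y b * χ z b) + ∑ v (χ (x ⊕ y)) + ∑ v (χ (x ⊕ z)) + ∑ v (χ (y ⊕ z))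
  ≡ ∑ v (χ x) + ∑ v (χ y) + ∑ v (χ z) + ∑ v (χ (x ⊕ y ⊕ z))
χ-triple-identity v x y z = begin
  4 * T + Sxy + Sxz + Syz
    ≡⟨ cong (λ w → w + Sxy + Sxz + Syz) (∑-* v 4 _) ⟨
  ∑ v (λ b → 4 * (χ x b * χ y b * χ z b)) + Sxy + Sxz + Syz
    ≡⟨ ∑-+₄ v _ _ _ _ ⟨
  ∑ v (λ b → 4 * (χ x b * χ y b * χ z b) + χ (x ⊕ y) b + χ (x ⊕ z) b + χ (y ⊕ z) b)
    ≡⟨ ∑-cong v pointwise ⟩
  ∑ v (λ b → χ x b + χ y b + χ z b + χ (x ⊕ y ⊕ z) b)
    ≡⟨ ∑-+₄ v _ _ _ _ ⟩
  ∑ v (χ x) + ∑ v (χ y) + ∑ v (χ z) + ∑ v (χ (x ⊕ y ⊕ z))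
    ∎
  where
  open ≡-Reasoning
  T Sxy Sxz Syz : ℕ
  T = ∑ v (λ b → χ x b * χ y b * χ z b)
  Sxy = ∑ v (χ (x ⊕ y))
  Sxz = ∑ v (χ (x ⊕ z))
  Syz = ∑ v (χ (y ⊕ z))
  pointwise : ∀ b → 4 * (χ x b * χ y b * χ z b) + χ (x ⊕ y) b + χ (x ⊕ z) b + χ (y ⊕ z) b
                    ≡ χ x b + χ y b + χ z b + χ (x ⊕ y ⊕ z) b
  pointwise b rewrite dot-⊕ʳ b (x ⊕ y) z | dot-⊕ʳ b x y | dot-⊕ʳ b x z | dot-⊕ʳ b y z =
    𝟙-xor₃ (dot b x) (dot b y) (dot b z)

-- Only a bound: the sum vanishes when x ⊕ y ⊕ z = 0.
χ-triple-sum-≤ : ∀ v (x y z : F₂^ v) → IsPoint x → IsPoint y → IsPoint z →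
                 x ≢ y → x ≢ z → y ≢ z →
                 8 * ∑ v (λ b → χ x b * χ y b * χ z b) ≤ 2 ^ v
χ-triple-sum-≤ v x y z x≢0 y≢0 z≢0 x≢y x≢z y≢z = +-cancelʳ-≤ (3 * N) (8 * T) N (begin
  8 * T + 3 * N                           ≡⟨ cong (8 * T +_) pairs ⟨
  8 * T + (2 * Sxy + 2 * Sxz + 2 * Syz)   ≡⟨ regroupˡ T Sxy Sxz Syz ⟩
  2 * (4 * T + Sxy + Sxz + Syz)           ≡⟨ cong (2 *_) (χ-triple-identity v x y z) ⟩
  2 * (Sx + Sy + Sz + Sxyz)               ≡⟨ regroupʳ Sx Sy Sz Sxyz ⟩
  (2 * Sx + 2 * Sy + 2 * Sz) + 2 * Sxyz   ≤⟨ +-mono-≤ (≤-reflexive singles) (χ-sum-≤ v (x ⊕ y ⊕ z)) ⟩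
  3 * N + N                               ≡⟨ +-comm (3 * N) N ⟩
  N + 3 * N                               ∎)
  where
  open ≤-Reasoning
  N T Sx Sy Sz Sxy Sxz Syz Sxyz : ℕ
  N = 2 ^ v
  T = ∑ v (λ b → χ x b * χ y b * χ z b)
  Sx = ∑ v (χ x)
  Sy = ∑ v (χ y)
  Sz = ∑ v (χ z)
  Sxy = ∑ v (χ (x ⊕ y))
  Sxz = ∑ v (χ (x ⊕ z))
  Syz = ∑ v (χ (y ⊕ z))
  Sxyz = ∑ v (χ (x ⊕ y ⊕ z))
  three : ∀ n → n + n + n ≡ 3 * n
  three = solve-∀
  regroupˡ : ∀ t a b c → 8 * t + (2 * a + 2 * b + 2 * c) ≡ 2 * (4 * t + a + b + c)
  regroupˡ = solve-∀
  regroupʳ : ∀ a b c d → 2 * (a + b + c + d) ≡ (2 * a + 2 * b + 2 * c) + 2 * d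
  regroupʳ = solve-∀
  pairs : 2 * Sxy + 2 * Sxz + 2 * Syz ≡ 3 * N
  pairs = trans (cong₂ _+_ (cong₂ _+_ (χ-sum v (x ⊕ y) (≢⇒⊕≢0 x≢y))
                                     (χ-sum v (x ⊕ z) (≢⇒⊕≢0 x≢z)))
                           (χ-sum v (y ⊕ z) (≢⇒⊕≢0 y≢z)))
                (three N)
  singles : 2 * Sx + 2 * Sy + 2 * Sz ≡ 3 * N
  singles = trans (cong₂ _+_ (cong₂ _+_ (χ-sum v x x≢0) (χ-sum v y y≢0)) (χ-sum v z z≢0)) (three N)

𝟙-square : ∀ c e → (𝟙 c + e) * (𝟙 c + e) ≡ 𝟙 c + 2 * (𝟙 c * e) + e * e
𝟙-square false e = refl
𝟙-square true e = expand e
  where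
  expand : ∀ e → (1 + e) * (1 + e) ≡ 1 + 2 * (1 * e) + e * e
  expand = solve-∀

𝟙-cube : ∀ c e → (𝟙 c + e) * (𝟙 c + e) * (𝟙 c + e)
                 ≡ 𝟙 c + 3 * (𝟙 c * e) + 3 * (𝟙 c * (e * e)) + e * e * e
𝟙-cube false e = refl
𝟙-cube true e = expand e
  where
  expand : ∀ e → (1 + e) * (1 + e) * (1 + e) ≡ 1 + 3 * (1 * e) + 3 * (1 * (e * e)) + e * e * e
  expand = solve-∀

module _ {v : ℕ} where

  private
    N : ℕ
    N = 2 ^ v

  ∑-wt : (D : List (F₂^ v)) → All IsPoint D → 2 * ∑ v (λ b → wt b D) ≡ length D * N
  ∑-wt [] [] = cong (2 *_) (∑-zero v)
  ∑-wt (x ∷ D) (x≢0 ∷ D≢0) =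
    trans (∑-scaled-+ v 2 (χ x) (λ b → wt b D)) (cong₂ _+_ (χ-sum v x x≢0) (∑-wt D D≢0))

  ∑-χwt : (x : F₂^ v) (D : List (F₂^ v)) → IsPoint x → All (x ≢_) D → All IsPoint D →
          4 * ∑ v (λ b → χ x b * wt b D) ≡ length D * N
  ∑-χwt x [] _ [] [] = cong (4 *_) (trans (∑-cong v (λ b → *-zeroʳ (χ x b))) (∑-zero v))
  ∑-χwt x (y ∷ D) x≢0 (x≢y ∷ x∉D) (y≢0 ∷ D≢0) = begin
    4 * ∑ v (λ b → χ x b * (χ y b + wt b D))
      ≡⟨ cong (4 *_) (∑-cong v (λ b → *-distribˡ-+ (χ x b) (χ y b) (wt b D))) ⟩
    4 * ∑ v (λ b → χ x b * χ y b + χ x b * wt b D)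
      ≡⟨ ∑-scaled-+ v 4 _ _ ⟩
    4 * ∑ v (λ b → χ x b * χ y b) + 4 * ∑ v (λ b → χ x b * wt b D)
      ≡⟨ cong₂ _+_ (χ-pair-sum v x y x≢0 y≢0 x≢y) (∑-χwt x D x≢0 x∉D D≢0) ⟩
    N + length D * N
      ∎
    where open ≡-Reasoning

  ∑-χχwt : (x y : F₂^ v) (D : List (F₂^ v)) → IsPoint x → IsPoint y → x ≢ y →
           All (x ≢_) D → All (y ≢_) D → All IsPoint D →
           8 * ∑ v (λ b → χ x b * χ y b * wt b D) ≤ length D * N
  ∑-χχwt x y [] _ _ _ [] [] [] =
    ≤-reflexive (cong (8 *_) (trans (∑-cong v (λ b → *-zeroʳ (χ x b * χ y b))) (∑-zero v)))
  ∑-χχwt x y (z ∷ D) x≢0 y≢0 x≢y (x≢z ∷ x∉D) (y≢z ∷ y∉D) (z≢0 ∷ D≢0) = begin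
    8 * ∑ v (λ b → χ x b * χ y b * (χ z b + wt b D))
      ≡⟨ cong (8 *_) (∑-cong v (λ b → *-distribˡ-+ (χ x b * χ y b) (χ z b) (wt b D))) ⟩
    8 * ∑ v (λ b → χ x b * χ y b * χ z b + χ x b * χ y b * wt b D)
      ≡⟨ ∑-scaled-+ v 8 _ _ ⟩
    8 * ∑ v (λ b → χ x b * χ y b * χ z b) + 8 * ∑ v (λ b → χ x b * χ y b * wt b D)
      ≤⟨ +-mono-≤ (χ-triple-sum-≤ v x y z x≢0 y≢0 z≢0 x≢y x≢z y≢z)
                  (∑-χχwt x y D x≢0 y≢0 x≢y x∉D y∉D D≢0) ⟩
    N + length D * N
      ∎
    where open ≤-Reasoning

  ∑-wt² : (D : List (F₂^ v)) → Unique D → All IsPoint D →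
          4 * ∑ v (λ b → wt b D * wt b D) ≡ length D * (length D + 1) * N
  ∑-wt² [] [] [] = cong (4 *_) (∑-zero v)
  ∑-wt² (x ∷ D) (x∉D ∷ D!) (x≢0 ∷ D≢0) = begin
    4 * ∑ v (λ b → (χ x b + wt b D) * (χ x b + wt b D))
      ≡⟨ cong (4 *_) (∑-cong v (λ b → 𝟙-square (dot b x) (wt b D))) ⟩
    4 * ∑ v (λ b → χ x b + 2 * (χ x b * wt b D) + wt b D * wt b D)
      ≡⟨ cong (4 *_) (∑-+₃ v _ _ _) ⟩
    4 * (A + ∑ v (λ b → 2 * (χ x b * wt b D)) + C)
      ≡⟨ cong (λ w → 4 * (A + w + C)) (∑-* v 2 _) ⟩
    4 * (A + 2 * B + C)
      ≡⟨ regroup A B C ⟩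
    2 * (2 * A) + 2 * (4 * B) + 4 * C
      ≡⟨ cong₂ _+_ (cong₂ _+_ (cong (2 *_) (χ-sum v x x≢0)) (cong (2 *_) (∑-χwt x D x≢0 x∉D D≢0)))
                   (∑-wt² D D! D≢0) ⟩
    2 * N + 2 * (m * N) + m * (m + 1) * N
      ≡⟨ collect m N ⟩
    suc m * (suc m + 1) * N
      ∎
    where
    open ≡-Reasoning
    m A B C : ℕ
    m = length D
    A = ∑ v (χ x)
    B = ∑ v (λ b → χ x b * wt b D)
    C = ∑ v (λ b → wt b D * wt b D)
    regroup : ∀ a b c → 4 * (a + 2 * b + c) ≡ 2 * (2 * a) + 2 * (4 * b) + 4 * c
    regroup = solve-∀
    collect : ∀ m n → 2 * n + 2 * (m * n) + m * (m + 1) * n ≡ suc m * (suc m + 1) * n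
    collect = solve-∀

  ∑-χwt² : (x : F₂^ v) (D : List (F₂^ v)) → IsPoint x → All (x ≢_) D → Unique D → All IsPoint D →
           8 * ∑ v (λ b → χ x b * (wt b D * wt b D)) ≤ length D * (length D + 1) * N
  ∑-χwt² x [] _ [] [] [] =
    ≤-reflexive (cong (8 *_) (trans (∑-cong v (λ b → *-zeroʳ (χ x b))) (∑-zero v)))
  ∑-χwt² x (y ∷ D) x≢0 (x≢y ∷ x∉D) (y∉D ∷ D!) (y≢0 ∷ D≢0) = begin
    8 * ∑ v (λ b → χ x b * ((χ y b + wt b D) * (χ y b + wt b D)))
      ≡⟨ cong (8 *_) (∑-cong v expand) ⟩
    8 * ∑ v (λ b → χ x b * χ y b + 2 * (χ x b * χ y b * wt b D) + χ x b * (wt b D * wt b D))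
      ≡⟨ cong (8 *_) (∑-+₃ v _ _ _) ⟩
    8 * (A + ∑ v (λ b → 2 * (χ x b * χ y b * wt b D)) + C)
      ≡⟨ cong (λ w → 8 * (A + w + C)) (∑-* v 2 _) ⟩
    8 * (A + 2 * B + C)
      ≡⟨ regroup A B C ⟩
    2 * (4 * A) + 2 * (8 * B) + 8 * C
      ≤⟨ +-mono-≤ (+-mono-≤ (≤-reflexive (cong (2 *_) (χ-pair-sum v x y x≢0 y≢0 x≢y)))
                            (*-monoʳ-≤ 2 (∑-χχwt x y D x≢0 y≢0 x≢y x∉D y∉D D≢0)))
                  (∑-χwt² x D x≢0 x∉D D! D≢0) ⟩
    2 * N + 2 * (m * N) + m * (m + 1) * N
      ≡⟨ collect m N ⟩
    suc m * (suc m + 1) * N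
      ∎
    where
    open ≤-Reasoning
    m A B C : ℕ
    m = length D
    A = ∑ v (λ b → χ x b * χ y b)
    B = ∑ v (λ b → χ x b * χ y b * wt b D)
    C = ∑ v (λ b → χ x b * (wt b D * wt b D))
    distribute : ∀ a q e → a * (q + 2 * (q * e) + e * e) ≡ a * q + 2 * (a * q * e) + a * (e * e)
    distribute = solve-∀
    expand : ∀ b → χ x b * ((χ y b + wt b D) * (χ y b + wt b D))
                   ≡ χ x b * χ y b + 2 * (χ x b * χ y b * wt b D) + χ x b * (wt b D * wt b D)
    expand b = trans (cong (χ x b *_) (𝟙-square (dot b y) (wt b D)))
                     (distribute (χ x b) (χ y b) (wt b D))
    regroup : ∀ a b c → 8 * (a + 2 * b + c) ≡ 2 * (4 * a) + 2 * (8 * b) + 8 * c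
    regroup = solve-∀
    collect : ∀ m n → 2 * n + 2 * (m * n) + m * (m + 1) * n ≡ suc m * (suc m + 1) * n
    collect = solve-∀

  ∑-wt³ : (D : List (F₂^ v)) → Unique D → All IsPoint D →
          8 * ∑ v (λ b → wt b D * wt b D * wt b D) ≤ length D * length D * (length D + 3) * N
  ∑-wt³ [] [] [] = ≤-reflexive (cong (8 *_) (∑-zero v))
  ∑-wt³ (x ∷ D) (x∉D ∷ D!) (x≢0 ∷ D≢0) = begin
    8 * ∑ v (λ b → (χ x b + wt b D) * (χ x b + wt b D) * (χ x b + wt b D))
      ≡⟨ cong (8 *_) (∑-cong v (λ b → 𝟙-cube (dot b x) (wt b D))) ⟩
    8 * ∑ v (λ b → χ x b + 3 * (χ x b * wt b D) + 3 * (χ x b * (wt b D * wt b D)) + wt b D * wt b D * wt b D)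
      ≡⟨ cong (8 *_) (∑-+₄ v _ _ _ _) ⟩
    8 * (A + ∑ v (λ b → 3 * (χ x b * wt b D)) + ∑ v (λ b → 3 * (χ x b * (wt b D * wt b D))) + G)
      ≡⟨ cong₂ (λ w u → 8 * (A + w + u + G)) (∑-* v 3 _) (∑-* v 3 _) ⟩
    8 * (A + 3 * B + 3 * C + G)
      ≡⟨ regroup A B C G ⟩
    4 * (2 * A) + 6 * (4 * B) + 3 * (8 * C) + 8 * G
      ≤⟨ +-mono-≤ (+-mono-≤ (≤-reflexive (cong₂ _+_ (cong (4 *_) (χ-sum v x x≢0))
                                                    (cong (6 *_) (∑-χwt x D x≢0 x∉D D≢0))))
                            (*-monoʳ-≤ 3 (∑-χwt² x D x≢0 x∉D D! D≢0)))
                  (∑-wt³ D D! D≢0) ⟩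
    4 * N + 6 * (m * N) + 3 * (m * (m + 1) * N) + m * m * (m + 3) * N
      ≡⟨ collect m N ⟩
    suc m * suc m * (suc m + 3) * N
      ∎
    where
    open ≤-Reasoning
    m A B C G : ℕ
    m = length D
    A = ∑ v (χ x)
    B = ∑ v (λ b → χ x b * wt b D)
    C = ∑ v (λ b → χ x b * (wt b D * wt b D))
    G = ∑ v (λ b → wt b D * wt b D * wt b D)
    regroup : ∀ a b c g → 8 * (a + 3 * b + 3 * c + g) ≡ 4 * (2 * a) + 6 * (4 * b) + 3 * (8 * c) + 8 * g
    regroup = solve-∀
    collect : ∀ m n → 4 * n + 6 * (m * n) + 3 * (m * (m + 1) * n) + m * m * (m + 3) * n
                      ≡ suc m * suc m * (suc m + 3) * n
    collect = solve-∀

-- Divisibility and the moment bounds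

DividesWeights : ∀ {v} → ℕ → List (F₂^ v) → Set
DividesWeights {v} Δ D = (b : F₂^ v) → Δ ∣ wt b D

-- (j − k)(j − k − 1) ≥ 0, as no integer lies strictly between k and k + 1.
quadratic-gap : ∀ j k → (2 * k + 1) * j ≤ j * j + k * (k + 1)
quadratic-gap j k with j ≤? k
... | yes j≤k = let d , j+d≡k = m≤n⇒∃[o]m+o≡n j≤k in
  subst (λ k → (2 * k + 1) * j ≤ j * j + k * (k + 1)) j+d≡k
        (≤-trans (m≤m+n _ (d * d + d)) (≤-reflexive (expand j d)))
  where
  expand : ∀ j d → (2 * (j + d) + 1) * j + (d * d + d) ≡ j * j + (j + d) * ((j + d) + 1)
  expand = solve-∀
... | no j≰k = let d , k+1+d≡j = m≤n⇒∃[o]m+o≡n (≰⇒> j≰k) in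
  subst (λ j → (2 * k + 1) * j ≤ j * j + k * (k + 1)) k+1+d≡j
        (≤-trans (m≤m+n _ (d * d + d)) (≤-reflexive (expand k d)))
  where
  expand : ∀ k d → (2 * k + 1) * (suc k + d) + (d * d + d) ≡ (suc k + d) * (suc k + d) + k * (k + 1)
  expand = solve-∀

weight-gap : ∀ Δ k e → Δ ∣ e → Δ * (2 * k + 1) * e ≤ e * e + Δ * Δ * (k * (k + 1))
weight-gap Δ k .(j * Δ) (divides j refl) = begin
  Δ * (2 * k + 1) * (j * Δ)       ≡⟨ regroupˡ Δ k j ⟩
  Δ * Δ * ((2 * k + 1) * j)       ≤⟨ *-monoʳ-≤ (Δ * Δ) (quadratic-gap j k) ⟩
  Δ * Δ * (j * j + k * (k + 1))   ≡⟨ regroupʳ Δ k j ⟩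
  j * Δ * (j * Δ) + Δ * Δ * (k * (k + 1)) ∎
  where
  open ≤-Reasoning
  regroupˡ : ∀ Δ k j → Δ * (2 * k + 1) * (j * Δ) ≡ Δ * Δ * ((2 * k + 1) * j)
  regroupˡ = solve-∀
  regroupʳ : ∀ Δ k j → Δ * Δ * (j * j + k * (k + 1)) ≡ j * Δ * (j * Δ) + Δ * Δ * (k * (k + 1))
  regroupʳ = solve-∀

weight-gap-cubed : ∀ Δ k e → Δ ∣ e →
                   Δ * (2 * k + 1) * (e * e) ≤ e * e * e + Δ * Δ * (k * (k + 1)) * e
weight-gap-cubed Δ k e Δ∣e = begin
  Δ * (2 * k + 1) * (e * e)   ≡⟨ *-assoc (Δ * (2 * k + 1)) e e ⟨
  Δ * (2 * k + 1) * e * e     ≤⟨ *-monoˡ-≤ e (weight-gap Δ k e Δ∣e) ⟩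
  (e * e + c) * e             ≡⟨ *-distribʳ-+ e (e * e) c ⟩
  e * e * e + c * e           ∎
  where
  open ≤-Reasoning
  c : ℕ
  c = Δ * Δ * (k * (k + 1))

MomentBounds : ℕ → ℕ → ℕ → Set
MomentBounds Δ n k =
  2 * a * n ≤ n * (n + 1) + 4 * c × 2 * a * (n * (n + 1)) ≤ n * n * (n + 3) + 4 * c * n
  where
  a c : ℕ
  a = Δ * (2 * k + 1)
  c = Δ * Δ * (k * (k + 1))

module _ {v : ℕ} (Δ : ℕ) (D : List (F₂^ v)) (Δ∣wt : DividesWeights Δ D) (D! : Unique D)
         (D≢0 : All IsPoint D) (k : ℕ) where

  private
    N n a c S₁ S₂ S₃ : ℕ
    N = 2 ^ v
    n = length D
    a = Δ * (2 * k + 1)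
    c = Δ * Δ * (k * (k + 1))
    S₁ = ∑ v (λ b → wt b D)
    S₂ = ∑ v (λ b → wt b D * wt b D)
    S₃ = ∑ v (λ b → wt b D * wt b D * wt b D)
    instance
      N≢0 : NonZero N
      N≢0 = m^n≢0 2 v

  quadratic-bound : 2 * a * n ≤ n * (n + 1) + 4 * c
  quadratic-bound = *-cancelʳ-≤ _ _ N (begin
    2 * a * n * N                ≡⟨ regroupˡ a n N ⟩
    2 * a * (n * N)              ≡⟨ cong (2 * a *_) (∑-wt D D≢0) ⟨
    2 * a * (2 * S₁)             ≡⟨ swap a S₁ ⟩
    4 * (a * S₁)                 ≡⟨ cong (4 *_) (∑-* v a _) ⟨
    4 * ∑ v (λ b → a * wt b D)
      ≤⟨ *-monoʳ-≤ 4 (∑-mono v (λ b → weight-gap Δ k (wt b D) (Δ∣wt b))) ⟩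
    4 * ∑ v (λ b → wt b D * wt b D + c) ≡⟨ cong (4 *_) (∑-+ v _ _) ⟩
    4 * (S₂ + ∑ v (λ _ → c))     ≡⟨ cong (λ w → 4 * (S₂ + w)) (∑-const v c) ⟩
    4 * (S₂ + N * c)             ≡⟨ regroupʳ S₂ N c ⟩
    4 * S₂ + 4 * c * N           ≡⟨ cong (_+ 4 * c * N) (∑-wt² D D! D≢0) ⟩
    n * (n + 1) * N + 4 * c * N  ≡⟨ *-distribʳ-+ N (n * (n + 1)) (4 * c) ⟨
    (n * (n + 1) + 4 * c) * N    ∎)
    where
    open ≤-Reasoning
    regroupˡ : ∀ a n N → 2 * a * n * N ≡ 2 * a * (n * N)
    regroupˡ = solve-∀
    swap : ∀ a s → 2 * a * (2 * s) ≡ 4 * (a * s)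
    swap = solve-∀
    regroupʳ : ∀ s N c → 4 * (s + N * c) ≡ 4 * s + 4 * c * N
    regroupʳ = solve-∀

  cubic-bound : 2 * a * (n * (n + 1)) ≤ n * n * (n + 3) + 4 * c * n
  cubic-bound = *-cancelʳ-≤ _ _ N (begin
    2 * a * (n * (n + 1)) * N                 ≡⟨ regroupˡ a (n * (n + 1)) N ⟩
    2 * a * (n * (n + 1) * N)                 ≡⟨ cong (2 * a *_) (∑-wt² D D! D≢0) ⟨
    2 * a * (4 * S₂)                          ≡⟨ swap a S₂ ⟩
    8 * (a * S₂)                              ≡⟨ cong (8 *_) (∑-* v a _) ⟨
    8 * ∑ v (λ b → a * (wt b D * wt b D))
      ≤⟨ *-monoʳ-≤ 8 (∑-mono v (λ b → weight-gap-cubed Δ k (wt b D) (Δ∣wt b))) ⟩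
    8 * ∑ v (λ b → wt b D * wt b D * wt b D + c * wt b D) ≡⟨ cong (8 *_) (∑-+ v _ _) ⟩
    8 * (S₃ + ∑ v (λ b → c * wt b D))         ≡⟨ cong (λ w → 8 * (S₃ + w)) (∑-* v c _) ⟩
    8 * (S₃ + c * S₁)                         ≡⟨ regroupʳ S₃ c S₁ ⟩
    8 * S₃ + 4 * c * (2 * S₁)
      ≤⟨ +-mono-≤ (∑-wt³ D D! D≢0) (≤-reflexive (cong (4 * c *_) (∑-wt D D≢0))) ⟩
    n * n * (n + 3) * N + 4 * c * (n * N)     ≡⟨ collect n c N ⟩
    (n * n * (n + 3) + 4 * c * n) * N         ∎)
    where
    open ≤-Reasoning
    regroupˡ : ∀ a m N → 2 * a * m * N ≡ 2 * a * (m * N)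
    regroupˡ = solve-∀
    swap : ∀ a s → 2 * a * (4 * s) ≡ 8 * (a * s)
    swap = solve-∀
    regroupʳ : ∀ s c t → 8 * (s + c * t) ≡ 8 * s + 4 * c * (2 * t)
    regroupʳ = solve-∀
    collect : ∀ n c N → n * n * (n + 3) * N + 4 * c * (n * N) ≡ (n * n * (n + 3) + 4 * c * n) * N
    collect = solve-∀

  moment-bounds : MomentBounds Δ n k
  moment-bounds = quadratic-bound , cubic-bound

momentBounds? : ∀ Δ n k → Dec (MomentBounds Δ n k)
momentBounds? Δ n k = (_ ≤? _) ×-dec (_ ≤? _)

decide-below : ∀ K {P : ℕ → Set} (P? : ∀ n → Dec (P n)) →
               True (all? (λ (i : Fin K) → P? (toℕ i))) → ∀ n → n < K → P n
decide-below K {P} P? ok n n<K = subst P (toℕ-fromℕ< n<K) (toWitness ok (fromℕ< n<K))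

-- The search for a violated bound is cut off at k < 5, which suffices for every size excluded below.
Obstructed : ℕ → ℕ → Set
Obstructed Δ n = ∃ λ (k : Fin 5) → ¬ MomentBounds Δ n (toℕ k)

obstructed? : ∀ Δ n → Dec (Obstructed Δ n)
obstructed? Δ n = any? (λ k → ¬? (momentBounds? Δ n (toℕ k)))

obstructed⇒¬dividesWeights : ∀ {v} Δ (D : List (F₂^ v)) → Obstructed Δ (length D) →
                             Unique D → All IsPoint D → ¬ DividesWeights Δ D
obstructed⇒¬dividesWeights Δ D (k , violated) D! D≢0 Δ∣wt =
  violated (moment-bounds Δ D Δ∣wt D! D≢0 (toℕ k))

-- Restriction to a hyperplane

infixl 5 _∩⊥_

_∩⊥_ : ∀ {v} → List (F₂^ v) → F₂^ v → List (F₂^ v)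
D ∩⊥ b = filter (λ x → dot b x Bool.≟ false) D

length-∩⊥ : ∀ {v} (b : F₂^ v) D → length (D ∩⊥ b) + wt b D ≡ length D
length-∩⊥ b [] = refl
length-∩⊥ b (x ∷ D) with dot b x
... | true = trans (+-suc _ _) (cong suc (length-∩⊥ b D))
... | false = cong suc (length-∩⊥ b D)

wt-∩⊥ : ∀ {v} (b c : F₂^ v) D → 2 * wt c (D ∩⊥ b) + wt b D ≡ wt c D + wt (b ⊕ c) D
wt-∩⊥ b c [] = refl
wt-∩⊥ b c (x ∷ D) rewrite dot-⊕ˡ b c x with dot b x
... | true = begin
  2 * k + suc e               ≡⟨ +-suc (2 * k) e ⟩
  suc (2 * k + e)             ≡⟨ cong suc (wt-∩⊥ b c D) ⟩
  1 + (l + r)                 ≡⟨ cong (_+ (l + r)) (𝟙-not (dot c x)) ⟨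
  (χ x c + 𝟙 (not (dot c x))) + (l + r) ≡⟨ +-interchange (χ x c) _ l r ⟩
  (χ x c + l) + (𝟙 (not (dot c x)) + r) ∎
  where
  open ≡-Reasoning
  k e l r : ℕ
  k = wt c (D ∩⊥ b)
  e = wt b D
  l = wt c D
  r = wt (b ⊕ c) D
... | false = begin
  2 * (g + k) + e             ≡⟨ regroup g k e ⟩
  (g + g) + (2 * k + e)       ≡⟨ cong ((g + g) +_) (wt-∩⊥ b c D) ⟩
  (g + g) + (l + r)           ≡⟨ +-interchange g g l r ⟩
  (g + l) + (g + r)           ∎
  where
  open ≡-Reasoning
  g k e l r : ℕ
  g = χ x c
  k = wt c (D ∩⊥ b)
  e = wt b D
  l = wt c D
  r = wt (b ⊕ c) D
  regroup : ∀ g k e → 2 * (g + k) + e ≡ (g + g) + (2 * k + e)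
  regroup = solve-∀

∩⊥-dividesWeights : ∀ {v} Δ (b : F₂^ v) D →
                    DividesWeights (2 * Δ) D → DividesWeights Δ (D ∩⊥ b)
∩⊥-dividesWeights Δ b D 2Δ∣wt c = *-cancelˡ-∣ 2 (∣m+n∣m⇒∣n 2Δ∣sum (2Δ∣wt b))
  where
  2Δ∣sum : 2 * Δ ∣ wt b D + 2 * wt c (D ∩⊥ b)
  2Δ∣sum = subst (2 * Δ ∣_) (trans (sym (wt-∩⊥ b c D)) (+-comm _ (wt b D)))
                 (∣m∣n⇒∣m+n (2Δ∣wt c) (2Δ∣wt (b ⊕ c)))

heavy-hyperplane : ∀ {v} c (D : List (F₂^ v)) → All IsPoint D →
                   2 * c < length D → ∃ λ b → c < wt b D
heavy-hyperplane {v} c D D≢0 2c<n = ∑>⇒∃> v (λ b → wt b D) c (*-cancelˡ-< 2 _ _ (begin-strict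
  2 * (N * c)                  ≡⟨ regroup N c ⟩
  2 * c * N                    <⟨ *-monoˡ-< N 2c<n ⟩
  length D * N                 ≡⟨ ∑-wt D D≢0 ⟨
  2 * ∑ v (λ b → wt b D)       ∎))
  where
  open ≤-Reasoning
  N : ℕ
  N = 2 ^ v
  instance
    N≢0 : NonZero N
    N≢0 = m^n≢0 2 v
  regroup : ∀ N c → 2 * (N * c) ≡ 2 * c * N
  regroup = solve-∀

hyperplane-cases-33 : ∀ w → w < 34 → w ≤ 16 ⊎ ¬ 8 ∣ w ⊎ Obstructed 4 (33 ∸ w)
hyperplane-cases-33 =
  decide-below 34 (λ w → w ≤? 16 ⊎-dec ¬? (8 ∣? w) ⊎-dec obstructed? 4 (33 ∸ w)) _

¬dividesWeights-8-33 : ∀ {v} (D : List (F₂^ v)) → length D ≡ 33 → Unique D → All IsPoint D →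
                       ¬ DividesWeights 8 D
¬dividesWeights-8-33 D n≡33 D! D≢0 8∣wt =
  let b , 16<w = heavy-hyperplane 16 D D≢0 (subst (32 <_) (sym n≡33) ≤-refl) in
  excluded b 16<w (hyperplane-cases-33 (wt b D) (s≤s (w≤33 b)))
  where
  w≤33 : ∀ b → wt b D ≤ 33
  w≤33 b = subst (wt b D ≤_) (trans (length-∩⊥ b D) n≡33) (m≤n+m _ _)
  excluded : ∀ b → 16 < wt b D → wt b D ≤ 16 ⊎ ¬ 8 ∣ wt b D ⊎ Obstructed 4 (33 ∸ wt b D) → ⊥
  excluded b 16<w (inj₁ w≤16) = <⇒≱ 16<w w≤16
  excluded b 16<w (inj₂ (inj₁ 8∤w)) = 8∤w (8∣wt b)
  excluded b 16<w (inj₂ (inj₂ obstructed)) =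
    obstructed⇒¬dividesWeights 4 (D ∩⊥ b) (subst (Obstructed 4) residual-size obstructed)
      (Uniqueₚ.filter⁺ _ D!) (Allₚ.filter⁺ _ D≢0) (∩⊥-dividesWeights 4 b D 8∣wt)
    where
    residual-size : 33 ∸ wt b D ≡ length (D ∩⊥ b)
    residual-size =
      trans (cong (_∸ wt b D) (sym (trans (length-∩⊥ b D) n≡33))) (m+n∸n≡m _ (wt b D))

record DivisibleSet (Δ n : ℕ) : Set where
  field
    {dim} : ℕ
    points : List (F₂^ (suc dim))
    unique : Unique points
    nonzero : All IsPoint points
    divisible : DividesWeights Δ points
    size : length points ≡ n

obstructed⇒∄ : ∀ {Δ n} → Obstructed Δ n → ¬ DivisibleSet Δ n
obstructed⇒∄ {Δ} obstructed S =
  obstructed⇒¬dividesWeights Δ points (subst (Obstructed Δ) (sym size) obstructed) unique nonzero divisible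
  where open DivisibleSet S

∄-8-33 : ¬ DivisibleSet 8 33
∄-8-33 S = ¬dividesWeights-8-33 points size unique nonzero divisible
  where open DivisibleSet S

countIn+wt : ∀ {v} (a : F₂^ v) C → countIn a C + wt a C ≡ length C
countIn+wt a [] = refl
countIn+wt a (x ∷ C) with dot a x
... | false = cong suc (countIn+wt a C)
... | true = trans (+-suc (countIn a C) (wt a C)) (cong suc (countIn+wt a C))

wt-zero : ∀ {v} (C : List (F₂^ v)) → wt (zeroVec v) C ≡ 0
wt-zero [] = refl
wt-zero (x ∷ C) rewrite dot-zeroˡ x = wt-zero C

%≡%⇒∣ : ∀ a e d .{{_ : NonZero d}} → a % d ≡ (a + e) % d → d ∣ e
%≡%⇒∣ a e d eq = ∣m+n∣m⇒∣n (subst (d ∣_) (sym shift) (n∣m*n ((a + e) / d))) (n∣m*n (a / d))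
  where
  open ≡-Reasoning
  shift : a / d * d + e ≡ (a + e) / d * d
  shift = +-cancelˡ-≡ (a % d) _ _ (begin
    a % d + (a / d * d + e)        ≡⟨ +-assoc (a % d) _ e ⟨
    a % d + a / d * d + e          ≡⟨ cong (_+ e) (m≡m%n+[m/n]*n a d) ⟨
    a + e                          ≡⟨ m≡m%n+[m/n]*n (a + e) d ⟩
    (a + e) % d + (a + e) / d * d  ≡⟨ cong (_+ (a + e) / d * d) eq ⟨
    a % d + (a + e) / d * d        ∎)

divisible⇔dividesWeights : ∀ {v} Δ .{{_ : NonZero Δ}} (C : List (F₂^ v)) →
                           Divisible Δ C ⇔ DividesWeights Δ C
divisible⇔dividesWeights {v} Δ C = mk⇔ to from
  where
  to : Divisible Δ C → DividesWeights Δ C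
  to div b with b ≟ᵛ zeroVec v
  ... | yes refl = divides 0 (wt-zero C)
  ... | no b≢0 =
    %≡%⇒∣ (countIn b C) (wt b C) Δ (trans (div b b≢0) (cong (_% Δ) (sym (countIn+wt b C))))
  from : DividesWeights Δ C → Divisible Δ C
  from Δ∣wt a _ with Δ∣wt a
  ... | divides q wt≡qΔ = begin
    countIn a C % Δ                 ≡⟨ [m+kn]%n≡m%n (countIn a C) q Δ ⟨
    (countIn a C + q * Δ) % Δ       ≡⟨ cong (λ w → (countIn a C + w) % Δ) wt≡qΔ ⟨
    (countIn a C + wt a C) % Δ      ≡⟨ cong (_% Δ) (countIn+wt a C) ⟩
    length C % Δ                    ∎
    where open ≡-Reasoning

ExistsDivSet⇔DivisibleSet : ∀ r n → ExistsDivSet r n ⇔ DivisibleSet (2 ^ r) n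
ExistsDivSet⇔DivisibleSet r n = mk⇔ to from
  where
  instance
    2^r≢0 : NonZero (2 ^ r)
    2^r≢0 = m^n≢0 2 r
  to : ExistsDivSet r n → DivisibleSet (2 ^ r) n
  to (_ , C , (C! , C≢0) , div , len) = record
    { points = C ; unique = C! ; nonzero = C≢0
    ; divisible = Equivalence.to (divisible⇔dividesWeights (2 ^ r) C) div ; size = len }
  from : DivisibleSet (2 ^ r) n → ExistsDivSet r n
  from S = dim , points , (unique , nonzero) , Equivalence.from (divisible⇔dividesWeights (2 ^ r) points) divisible
          , size
    where open DivisibleSet S

-- Constructions

dot-++ : ∀ {a c} (b₁ x₁ : F₂^ a) (b₂ x₂ : F₂^ c) →
         dot (b₁ ++ᵛ b₂) (x₁ ++ᵛ x₂) ≡ dot b₁ x₁ xor dot b₂ x₂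
dot-++ [] [] b₂ x₂ = refl
dot-++ (b₀ ∷ b₁) (x₀ ∷ x₁) b₂ x₂ =
  trans (cong ((b₀ ∧ x₀) xor_) (dot-++ b₁ x₁ b₂ x₂)) (sym (xor-assoc (b₀ ∧ x₀) (dot b₁ x₁) (dot b₂ x₂)))

zero-++ : ∀ a c → zeroVec (a + c) ≡ zeroVec a ++ᵛ zeroVec c
zero-++ zero c = refl
zero-++ (suc a) c = cong (false ∷_) (zero-++ a c)

wt-++ : ∀ {v} (b : F₂^ v) xs ys → wt b (xs ++ ys) ≡ wt b xs + wt b ys
wt-++ b xs ys = trans (cong sum (map-++ _ xs ys)) (sum-++ (map (λ x → χ x b) xs) _)

wt-map : ∀ {a c} (f : F₂^ a → F₂^ c) (b : F₂^ a) (b′ : F₂^ c) →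
         (∀ x → dot b′ (f x) ≡ dot b x) → ∀ C → wt b′ (map f C) ≡ wt b C
wt-map f b b′ eq [] = refl
wt-map f b b′ eq (x ∷ C) = cong₂ _+_ (cong 𝟙 (eq x)) (wt-map f b b′ eq C)

directSum : ∀ {a c} → List (F₂^ a) → List (F₂^ c) → List (F₂^ (a + c))
directSum {a} {c} C₁ C₂ = map (_++ᵛ zeroVec c) C₁ ++ map (zeroVec a ++ᵛ_) C₂

module _ {a c : ℕ} (C₁ : List (F₂^ a)) (C₂ : List (F₂^ c)) where

  directSum-wt : ∀ b₁ b₂ → wt (b₁ ++ᵛ b₂) (directSum C₁ C₂) ≡ wt b₁ C₁ + wt b₂ C₂
  directSum-wt b₁ b₂ =
    trans (wt-++ (b₁ ++ᵛ b₂) (map (_++ᵛ zeroVec c) C₁) _)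
          (cong₂ _+_ (wt-map (_++ᵛ zeroVec c) b₁ (b₁ ++ᵛ b₂) onˡ C₁)
                     (wt-map (zeroVec a ++ᵛ_) b₂ (b₁ ++ᵛ b₂) onʳ C₂))
    where
    onˡ : ∀ x → dot (b₁ ++ᵛ b₂) (x ++ᵛ zeroVec c) ≡ dot b₁ x
    onˡ x = trans (dot-++ b₁ x b₂ (zeroVec c))
                  (trans (cong (dot b₁ x xor_) (dot-zeroʳ b₂)) (xor-identityʳ (dot b₁ x)))
    onʳ : ∀ y → dot (b₁ ++ᵛ b₂) (zeroVec a ++ᵛ y) ≡ dot b₂ y
    onʳ y = trans (dot-++ b₁ (zeroVec a) b₂ y) (cong (_xor dot b₂ y) (dot-zeroʳ b₁))

  directSum-length : length (directSum C₁ C₂) ≡ length C₁ + length C₂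
  directSum-length = trans (length-++ (map _ C₁)) (cong₂ _+_ (length-map _ C₁) (length-map _ C₂))

  directSum-nonzero : All IsPoint C₁ → All IsPoint C₂ → All IsPoint (directSum C₁ C₂)
  directSum-nonzero C₁≢0 C₂≢0 =
    Allₚ.++⁺ (Allₚ.map⁺ (All.map left C₁≢0)) (Allₚ.map⁺ (All.map right C₂≢0))
    where
    left : ∀ {x} → IsPoint x → IsPoint (x ++ᵛ zeroVec c)
    left {x} x≢0 eq = x≢0 (++-injectiveˡ x (zeroVec a) (trans eq (zero-++ a c)))
    right : ∀ {y} → IsPoint y → IsPoint (zeroVec a ++ᵛ y)
    right y≢0 eq = y≢0 (++-injectiveʳ (zeroVec a) (zeroVec a) (trans eq (zero-++ a c)))

  directSum-unique : Unique C₁ → All IsPoint C₁ → Unique C₂ → Unique (directSum C₁ C₂)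
  directSum-unique C₁! C₁≢0 C₂! =
    Uniqueₚ.++⁺ (Uniqueₚ.map⁺ (λ {x} {y} → ++-injectiveˡ x y) C₁!)
               (Uniqueₚ.map⁺ (++-injectiveʳ (zeroVec a) (zeroVec a)) C₂!) disjoint
    where
    disjoint : ∀ {z} → ¬ (z ∈ map (_++ᵛ zeroVec c) C₁ × z ∈ map (zeroVec a ++ᵛ_) C₂)
    disjoint (z∈₁ , z∈₂) with ∈-map⁻ _ z∈₁ | ∈-map⁻ _ z∈₂
    ... | x , x∈C₁ , refl | y , _ , eq = All.lookup C₁≢0 x∈C₁ (++-injectiveˡ x (zeroVec a) eq)

infixr 6 _⊞_

_⊞_ : ∀ {Δ m n} → DivisibleSet Δ m → DivisibleSet Δ n → DivisibleSet Δ (m + n)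
_⊞_ {Δ} S T = record
  { points = directSum S.points T.points
  ; unique = directSum-unique S.points T.points S.unique S.nonzero T.unique
  ; nonzero = directSum-nonzero S.points T.points S.nonzero T.nonzero
  ; divisible = divisible
  ; size = trans (directSum-length S.points T.points) (cong₂ _+_ S.size T.size)
  }
  where
  module S = DivisibleSet S
  module T = DivisibleSet T
  divisible : DividesWeights Δ (directSum S.points T.points)
  divisible b with splitAt (suc S.dim) b
  ... | b₁ , b₂ , refl = subst (Δ ∣_) (sym (directSum-wt S.points T.points b₁ b₂))
                                (∣m∣n⇒∣m+n (S.divisible b₁) (T.divisible b₂))

replicate-⊞ : ∀ {Δ p n} → DivisibleSet Δ p → ∀ q → DivisibleSet Δ n → DivisibleSet Δ (q * p + n)
replicate-⊞ P zero S = S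
replicate-⊞ {Δ} {p} {n} P (suc q) S =
  subst (DivisibleSet Δ) (sym (+-assoc p (q * p) n)) (P ⊞ replicate-⊞ P q S)

sizes-from : ∀ {Δ} t p .{{_ : NonZero p}} → DivisibleSet Δ p →
             All (λ i → DivisibleSet Δ (t + i)) (upTo p) → ∀ n → t ≤ n → DivisibleSet Δ n
sizes-from {Δ} t p P bases n t≤n with m≤n⇒∃[o]m+o≡n t≤n
... | d , refl =
  subst (DivisibleSet Δ) size (replicate-⊞ P (d / p) (All.lookup bases (∈-upTo⁺ (m%n<n d p))))
  where
  regroup : ∀ q r t → q + (t + r) ≡ t + (r + q)
  regroup = solve-∀
  size : d / p * p + (t + d % p) ≡ t + d
  size = trans (regroup (d / p * p) (d % p) t) (cong (t +_) (sym (m≡m%n+[m/n]*n d p)))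

∀F₂? : ∀ v {P : F₂^ v → Set} → (∀ b → Dec (P b)) → Dec (∀ b → P b)
∀F₂? zero P? = map′ (λ p → λ { [] → p }) (λ f → f []) (P? [])
∀F₂? (suc v) {P} P? = map′ split (λ f → f ∘ (false ∷_) , f ∘ (true ∷_))
                           (∀F₂? v (P? ∘ (false ∷_)) ×-dec ∀F₂? v (P? ∘ (true ∷_)))
  where
  split : (∀ b → P (false ∷ b)) × (∀ b → P (true ∷ b)) → ∀ b → P b
  split (p₀ , p₁) (false ∷ b) = p₀ b
  split (p₀ , p₁) (true ∷ b) = p₁ b

isDivisibleSet? : ∀ {v} Δ (C : List (F₂^ v)) → Dec (Unique C × All IsPoint C × DividesWeights Δ C)
isDivisibleSet? {v} Δ C =
  UniqueDec.unique? _≟ᵛ_ C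
  ×-dec All.all? (λ x → ¬? (x ≟ᵛ zeroVec v)) C
  ×-dec ∀F₂? v (λ b → Δ ∣? wt b C)

certify : ∀ {w} Δ (C : List (F₂^ (suc w))) → True (isDivisibleSet? Δ C) → DivisibleSet Δ (length C)
certify Δ C ok = let C! , C≢0 , Δ∣wt = toWitness ok in
  record { points = C ; unique = C! ; nonzero = C≢0 ; divisible = Δ∣wt ; size = refl }

-- Points are written as integers through their binary digits, least significant first.
bits : (v : ℕ) → ℕ → F₂^ v
bits zero _ = []
bits (suc v) n = (n % 2 ≡ᵇ 1) ∷ bits v (n / 2)

div2-3 : DivisibleSet 2 3
div2-3 = certify 2 (map (bits 2) (1 ∷ 2 ∷ 3 ∷ [])) _

div2-4 : DivisibleSet 2 4
div2-4 = certify 2 (map (bits 3) (1 ∷ 3 ∷ 5 ∷ 7 ∷ [])) _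

div2-5 : DivisibleSet 2 5
div2-5 = certify 2 (map (bits 4) (2 ∷ 8 ∷ 9 ∷ 12 ∷ 15 ∷ [])) _

div4-7 : DivisibleSet 4 7
div4-7 = certify 4 (map (bits 3) (1 ∷ 2 ∷ 3 ∷ 4 ∷ 5 ∷ 6 ∷ 7 ∷ [])) _

div4-8 : DivisibleSet 4 8
div4-8 = certify 4 (map (bits 4) (8 ∷ 9 ∷ 10 ∷ 11 ∷ 12 ∷ 13 ∷ 14 ∷ 15 ∷ [])) _

div8-15 : DivisibleSet 8 15
div8-15 = certify 8 (map (bits 4)
  (1 ∷ 2 ∷ 3 ∷ 4 ∷ 5 ∷ 6 ∷ 7 ∷ 8 ∷ 9 ∷ 10 ∷ 11 ∷ 12 ∷ 13 ∷ 14 ∷ 15 ∷ [])) _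

div8-16 : DivisibleSet 8 16
div8-16 = certify 8 (map (bits 5)
  (16 ∷ 17 ∷ 18 ∷ 19 ∷ 20 ∷ 21 ∷ 22 ∷ 23 ∷ 24 ∷ 25 ∷ 26 ∷ 27 ∷ 28 ∷ 29 ∷ 30 ∷ 31 ∷ [])) _

div4-17 : DivisibleSet 4 17
div4-17 = certify 4 (map (bits 6)
  (11 ∷ 16 ∷ 17 ∷ 18 ∷ 19 ∷ 20 ∷ 21 ∷ 23 ∷ 29 ∷ 34 ∷ 40 ∷ 46 ∷ 47 ∷ 52 ∷ 56 ∷ 57 ∷ 62 ∷ [])) _

div4-18 : DivisibleSet 4 18
div4-18 = certify 4 (map (bits 6)
  (5 ∷ 14 ∷ 17 ∷ 18 ∷ 20 ∷ 21 ∷ 22 ∷ 24 ∷ 25 ∷ 30 ∷ 36 ∷ 38 ∷ 39 ∷ 46 ∷ 52 ∷ 57 ∷ 59 ∷ 61 ∷ [])) _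

div4-19 : DivisibleSet 4 19
div4-19 = certify 4 (map (bits 8)
  (1 ∷ 2 ∷ 4 ∷ 14 ∷ 16 ∷ 27 ∷ 29 ∷ 76 ∷ 84 ∷ 88 ∷ 95 ∷ 133 ∷ 144 ∷ 151 ∷ 157 ∷ 192 ∷ 214 ∷ 215 ∷
   222 ∷ [])) _

div4-20 : DivisibleSet 4 20
div4-20 = certify 4 (map (bits 8)
  (2 ∷ 4 ∷ 14 ∷ 16 ∷ 27 ∷ 29 ∷ 76 ∷ 78 ∷ 79 ∷ 84 ∷ 88 ∷ 95 ∷ 133 ∷ 144 ∷ 151 ∷ 152 ∷ 153 ∷ 157 ∷
   192 ∷ 222 ∷ [])) _

div8-49 : DivisibleSet 8 49
div8-49 = certify 8 (map (bits 8)
  (1 ∷ 6 ∷ 7 ∷ 11 ∷ 12 ∷ 13 ∷ 20 ∷ 21 ∷ 31 ∷ 32 ∷ 42 ∷ 46 ∷ 48 ∷ 66 ∷ 69 ∷ 72 ∷ 78 ∷ 79 ∷ 80 ∷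
   81 ∷ 91 ∷ 99 ∷ 105 ∷ 106 ∷ 116 ∷ 134 ∷ 135 ∷ 141 ∷ 147 ∷ 149 ∷ 152 ∷ 153 ∷ 159 ∷ 162 ∷ 180 ∷
   188 ∷ 190 ∷ 194 ∷ 195 ∷ 201 ∷ 208 ∷ 209 ∷ 218 ∷ 219 ∷ 220 ∷ 230 ∷ 247 ∷ 248 ∷ 253 ∷ [])) _

div8-50 : DivisibleSet 8 50
div8-50 = certify 8 (map (bits 8)
  (3 ∷ 5 ∷ 9 ∷ 17 ∷ 22 ∷ 28 ∷ 30 ∷ 34 ∷ 35 ∷ 65 ∷ 67 ∷ 71 ∷ 73 ∷ 77 ∷ 90 ∷ 94 ∷ 112 ∷ 113 ∷ 118 ∷
   119 ∷ 122 ∷ 123 ∷ 131 ∷ 132 ∷ 140 ∷ 142 ∷ 148 ∷ 156 ∷ 158 ∷ 164 ∷ 165 ∷ 170 ∷ 171 ∷ 176 ∷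
   177 ∷ 200 ∷ 204 ∷ 216 ∷ 224 ∷ 225 ∷ 11 ∷ 69 ∷ 78 ∷ 79 ∷ 147 ∷ 152 ∷ 153 ∷ 214 ∷ 215 ∷ 220 ∷ [])) _

div8-51 : DivisibleSet 8 51
div8-51 = certify 8 (map (bits 8)
  (1 ∷ 15 ∷ 26 ∷ 36 ∷ 38 ∷ 44 ∷ 59 ∷ 85 ∷ 89 ∷ 96 ∷ 100 ∷ 145 ∷ 150 ∷ 169 ∷ 185 ∷ 193 ∷ 223 ∷ 3 ∷
   5 ∷ 17 ∷ 28 ∷ 32 ∷ 46 ∷ 51 ∷ 55 ∷ 77 ∷ 94 ∷ 103 ∷ 106 ∷ 108 ∷ 114 ∷ 116 ∷ 124 ∷ 132 ∷ 156 ∷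
   160 ∷ 167 ∷ 172 ∷ 174 ∷ 180 ∷ 190 ∷ 214 ∷ 215 ∷ 226 ∷ 230 ∷ 233 ∷ 235 ∷ 239 ∷ 244 ∷ 253 ∷
   255 ∷ [])) _

div8-68 : DivisibleSet 8 68
div8-68 = certify 8 (map (bits 8)
  (2 ∷ 4 ∷ 14 ∷ 16 ∷ 27 ∷ 29 ∷ 30 ∷ 31 ∷ 35 ∷ 40 ∷ 43 ∷ 49 ∷ 52 ∷ 57 ∷ 60 ∷ 63 ∷ 66 ∷ 67 ∷ 72 ∷
   73 ∷ 76 ∷ 78 ∷ 79 ∷ 84 ∷ 88 ∷ 90 ∷ 91 ∷ 95 ∷ 98 ∷ 104 ∷ 111 ∷ 113 ∷ 118 ∷ 121 ∷ 122 ∷ 126 ∷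
   133 ∷ 140 ∷ 141 ∷ 144 ∷ 148 ∷ 149 ∷ 151 ∷ 152 ∷ 153 ∷ 157 ∷ 158 ∷ 159 ∷ 163 ∷ 165 ∷ 170 ∷
   176 ∷ 178 ∷ 183 ∷ 187 ∷ 189 ∷ 192 ∷ 200 ∷ 201 ∷ 222 ∷ 224 ∷ 229 ∷ 236 ∷ 240 ∷ 243 ∷ 246 ∷
   249 ∷ 250 ∷ [])) _

div8-69 : DivisibleSet 8 69
div8-69 = certify 8 (map (bits 9)
  (11 ∷ 12 ∷ 14 ∷ 19 ∷ 22 ∷ 23 ∷ 25 ∷ 29 ∷ 31 ∷ 37 ∷ 38 ∷ 39 ∷ 42 ∷ 43 ∷ 44 ∷ 49 ∷ 50 ∷ 53 ∷ 57 ∷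
   58 ∷ 60 ∷ 64 ∷ 65 ∷ 66 ∷ 67 ∷ 68 ∷ 69 ∷ 70 ∷ 71 ∷ 128 ∷ 136 ∷ 144 ∷ 152 ∷ 160 ∷ 168 ∷ 176 ∷
   184 ∷ 192 ∷ 201 ∷ 210 ∷ 219 ∷ 228 ∷ 237 ∷ 246 ∷ 255 ∷ 256 ∷ 266 ∷ 276 ∷ 286 ∷ 291 ∷ 297 ∷
   311 ∷ 317 ∷ 320 ∷ 335 ∷ 341 ∷ 346 ∷ 353 ∷ 366 ∷ 372 ∷ 379 ∷ 384 ∷ 397 ∷ 401 ∷ 412 ∷ 418 ∷
   431 ∷ 435 ∷ 446 ∷ [])) _

div8-70 : DivisibleSet 8 70
div8-70 = certify 8 (map (bits 9)
  (1 ∷ 13 ∷ 28 ∷ 29 ∷ 33 ∷ 35 ∷ 39 ∷ 46 ∷ 49 ∷ 55 ∷ 66 ∷ 73 ∷ 81 ∷ 86 ∷ 97 ∷ 100 ∷ 118 ∷ 127 ∷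
   128 ∷ 132 ∷ 140 ∷ 143 ∷ 149 ∷ 158 ∷ 171 ∷ 173 ∷ 180 ∷ 184 ∷ 186 ∷ 188 ∷ 193 ∷ 195 ∷ 198 ∷
   201 ∷ 227 ∷ 230 ∷ 240 ∷ 248 ∷ 259 ∷ 264 ∷ 266 ∷ 269 ∷ 288 ∷ 291 ∷ 311 ∷ 312 ∷ 323 ∷ 329 ∷
   332 ∷ 333 ∷ 336 ∷ 337 ∷ 339 ∷ 343 ∷ 345 ∷ 346 ∷ 357 ∷ 360 ∷ 387 ∷ 393 ∷ 411 ∷ 412 ∷ 421 ∷
   422 ∷ 432 ∷ 446 ∷ 471 ∷ 475 ∷ 499 ∷ 511 ∷ [])) _

div8-71 : DivisibleSet 8 71
div8-71 = certify 8 (map (bits 10)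
  (12 ∷ 19 ∷ 31 ∷ 38 ∷ 42 ∷ 53 ∷ 57 ∷ 64 ∷ 65 ∷ 66 ∷ 67 ∷ 68 ∷ 69 ∷ 70 ∷ 71 ∷ 128 ∷ 136 ∷ 144 ∷
   152 ∷ 160 ∷ 168 ∷ 176 ∷ 184 ∷ 192 ∷ 201 ∷ 210 ∷ 219 ∷ 228 ∷ 237 ∷ 246 ∷ 255 ∷ 256 ∷ 266 ∷
   276 ∷ 286 ∷ 291 ∷ 297 ∷ 311 ∷ 317 ∷ 320 ∷ 335 ∷ 341 ∷ 346 ∷ 353 ∷ 366 ∷ 372 ∷ 379 ∷ 384 ∷
   397 ∷ 401 ∷ 412 ∷ 418 ∷ 431 ∷ 435 ∷ 446 ∷ 448 ∷ 459 ∷ 470 ∷ 477 ∷ 487 ∷ 492 ∷ 497 ∷ 506 ∷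
   512 ∷ 526 ∷ 535 ∷ 537 ∷ 549 ∷ 555 ∷ 562 ∷ 572 ∷ [])) _

div8-72 : DivisibleSet 8 72
div8-72 = certify 8 (map (bits 10)
  (64 ∷ 65 ∷ 66 ∷ 67 ∷ 68 ∷ 69 ∷ 70 ∷ 71 ∷ 128 ∷ 136 ∷ 144 ∷ 152 ∷ 160 ∷ 168 ∷ 176 ∷ 184 ∷ 192 ∷
   201 ∷ 210 ∷ 219 ∷ 228 ∷ 237 ∷ 246 ∷ 255 ∷ 256 ∷ 266 ∷ 276 ∷ 286 ∷ 291 ∷ 297 ∷ 311 ∷ 317 ∷
   320 ∷ 335 ∷ 341 ∷ 346 ∷ 353 ∷ 366 ∷ 372 ∷ 379 ∷ 384 ∷ 397 ∷ 401 ∷ 412 ∷ 418 ∷ 431 ∷ 435 ∷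
   446 ∷ 448 ∷ 459 ∷ 470 ∷ 477 ∷ 487 ∷ 492 ∷ 497 ∷ 506 ∷ 512 ∷ 526 ∷ 535 ∷ 537 ∷ 549 ∷ 555 ∷
   562 ∷ 572 ∷ 576 ∷ 588 ∷ 595 ∷ 607 ∷ 614 ∷ 618 ∷ 629 ∷ 633 ∷ [])) _

div8-73 : DivisibleSet 8 73
div8-73 = certify 8 (map (bits 10)
  (1 ∷ 10 ∷ 15 ∷ 48 ∷ 52 ∷ 58 ∷ 68 ∷ 70 ∷ 85 ∷ 90 ∷ 123 ∷ 170 ∷ 202 ∷ 221 ∷ 236 ∷ 237 ∷ 240 ∷
   265 ∷ 275 ∷ 281 ∷ 283 ∷ 309 ∷ 330 ∷ 333 ∷ 352 ∷ 360 ∷ 366 ∷ 445 ∷ 470 ∷ 471 ∷ 485 ∷ 490 ∷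
   511 ∷ 513 ∷ 542 ∷ 544 ∷ 557 ∷ 565 ∷ 566 ∷ 569 ∷ 621 ∷ 627 ∷ 634 ∷ 654 ∷ 655 ∷ 697 ∷ 747 ∷
   748 ∷ 755 ∷ 769 ∷ 773 ∷ 827 ∷ 835 ∷ 837 ∷ 851 ∷ 856 ∷ 871 ∷ 874 ∷ 883 ∷ 898 ∷ 903 ∷ 904 ∷
   907 ∷ 936 ∷ 954 ∷ 955 ∷ 966 ∷ 983 ∷ 992 ∷ 993 ∷ 1006 ∷ 1007 ∷ 1010 ∷ [])) _

div8-74 : DivisibleSet 8 74
div8-74 = certify 8 (map (bits 11)
  (66 ∷ 67 ∷ 68 ∷ 69 ∷ 70 ∷ 71 ∷ 144 ∷ 152 ∷ 160 ∷ 168 ∷ 176 ∷ 184 ∷ 210 ∷ 219 ∷ 228 ∷ 237 ∷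
   246 ∷ 255 ∷ 266 ∷ 286 ∷ 291 ∷ 297 ∷ 311 ∷ 317 ∷ 335 ∷ 346 ∷ 353 ∷ 366 ∷ 372 ∷ 379 ∷ 397 ∷
   401 ∷ 418 ∷ 431 ∷ 435 ∷ 446 ∷ 459 ∷ 470 ∷ 487 ∷ 492 ∷ 497 ∷ 506 ∷ 512 ∷ 526 ∷ 535 ∷ 537 ∷
   549 ∷ 555 ∷ 562 ∷ 572 ∷ 576 ∷ 588 ∷ 595 ∷ 607 ∷ 614 ∷ 618 ∷ 629 ∷ 633 ∷ 1024 ∷ 1088 ∷ 1152 ∷
   1216 ∷ 1280 ∷ 1344 ∷ 1408 ∷ 1472 ∷ 1536 ∷ 1601 ∷ 1672 ∷ 1737 ∷ 1812 ∷ 1877 ∷ 1948 ∷ 2013 ∷ [])) _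

div8-30 : DivisibleSet 8 30
div8-30 = div8-15 ⊞ div8-15

div8-31 : DivisibleSet 8 31
div8-31 = div8-15 ⊞ div8-16

div8-32 : DivisibleSet 8 32
div8-32 = div8-16 ⊞ div8-16

-- n ≡ a₁ ⊎ (n ≡ a₂ ⊎ (… ⊎ Q)) and n ≡ a₁ ⊎ (… ⊎ n ≡ aₘ), the two shapes in which the
-- theorem lists sizes.
AnyOf : List ℕ → Set → ℕ → Set
AnyOf [] Q n = Q
AnyOf (a ∷ as) Q n = n ≡ a ⊎ AnyOf as Q n

OneOf : List ℕ → ℕ → Set
OneOf [] n = ⊥
OneOf (a ∷ []) n = n ≡ a
OneOf (a ∷ b ∷ bs) n = n ≡ a ⊎ OneOf (b ∷ bs) n

oneOf? : ∀ as n → Dec (OneOf as n)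
oneOf? [] n = no λ ()
oneOf? (a ∷ []) n = n ≟ a
oneOf? (a ∷ b ∷ bs) n = n ≟ a ⊎-dec oneOf? (b ∷ bs) n

anyOf-elim : ∀ {P : ℕ → Set} {Q} as n → All P as → (Q → P n) → AnyOf as Q n → P n
anyOf-elim [] n [] fromQ q = fromQ q
anyOf-elim (a ∷ as) n (Pa ∷ _) _ (inj₁ refl) = Pa
anyOf-elim (a ∷ as) n (_ ∷ Pas) fromQ (inj₂ h) = anyOf-elim as n Pas fromQ h

exists : ∀ r {n} → DivisibleSet (2 ^ r) n → ExistsDivSet r n
exists r {n} = Equivalence.from (ExistsDivSet⇔DivisibleSet r n)

nonexistent : ∀ r {n} → ¬ DivisibleSet (2 ^ r) n → ¬ ExistsDivSet r n
nonexistent r {n} ∄ = ∄ ∘ Equivalence.to (ExistsDivSet⇔DivisibleSet r n)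

excluded-by-moments : ∀ Δ n → True (obstructed? Δ n) → ¬ DivisibleSet Δ n
excluded-by-moments Δ n = obstructed⇒∄ ∘ toWitness

isF2-intro : ∀ r m → 1 ≤ m → (∀ n → m < n → ExistsDivSet r n) → ¬ ExistsDivSet r m → IsF2 r m
isF2-intro r m 1≤m above ∄m = 1≤m , above , λ k _ k<m above-k → ∄m (above-k m k<m)

isF2-between : ∀ r {m a b} → IsF2 r m → ¬ ExistsDivSet r a →
               1 ≤ b → (∀ n → b < n → ExistsDivSet r n) → a ≤ m × m ≤ b
isF2-between _ (_ , above , minimal) ∄a 1≤b above-b =
  ≮⇒≥ (λ m<a → ∄a (above _ m<a)) , ≮⇒≥ (λ b<m → minimal _ 1≤b b<m above-b)

a≤m≤1+a⇒m≡a⊎m≡1+a : ∀ {a m} → a ≤ m → m ≤ suc a → m ≡ a ⊎ m ≡ suc a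
a≤m≤1+a⇒m≡a⊎m≡1+a {a} {m} a≤m m≤1+a with m ≟ a
... | yes m≡a = inj₁ m≡a
... | no m≢a = inj₂ (≤-antisym m≤1+a (≤∧≢⇒< a≤m (≢-sym m≢a)))

sizes≥3 : ∀ n → 3 ≤ n → DivisibleSet 2 n
sizes≥3 = sizes-from 3 3 div2-3 (div2-3 ∷ div2-4 ∷ div2-5 ∷ [])

sizes≥14 : ∀ n → 14 ≤ n → DivisibleSet 4 n
sizes≥14 = sizes-from 14 7 div4-7
  (div4-7 ⊞ div4-7 ∷ div4-7 ⊞ div4-8 ∷ div4-8 ⊞ div4-8 ∷ div4-17 ∷ div4-18 ∷ div4-19 ∷ div4-20 ∷ [])

sizes≥60 : ∀ n → 60 ≤ n → DivisibleSet 8 n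
sizes≥60 = sizes-from 60 15 div8-15
  ( div8-30 ⊞ div8-30 ∷ div8-30 ⊞ div8-31 ∷ div8-31 ⊞ div8-31 ∷ div8-31 ⊞ div8-32 ∷ div8-32 ⊞ div8-32
  ∷ div8-49 ⊞ div8-16 ∷ div8-50 ⊞ div8-16 ∷ div8-51 ⊞ div8-16
  ∷ div8-68 ∷ div8-69 ∷ div8-70 ∷ div8-71 ∷ div8-72 ∷ div8-73 ∷ div8-74 ∷ [])

sporadic₃ : List ℕ
sporadic₃ = 15 ∷ 16 ∷ 30 ∷ 31 ∷ 32 ∷ 45 ∷ 46 ∷ 47 ∷ 48 ∷ 49 ∷ 50 ∷ 51 ∷ []

sporadic₃-sets : All (DivisibleSet 8) sporadic₃
sporadic₃-sets =
  div8-15 ∷ div8-16 ∷ div8-30 ∷ div8-31 ∷ div8-32 ∷ div8-15 ⊞ div8-30 ∷ div8-15 ⊞ div8-31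
  ∷ div8-15 ⊞ div8-32 ∷ div8-16 ⊞ div8-32 ∷ div8-49 ∷ div8-50 ∷ div8-51 ∷ []

sizes<14 : ∀ n → n < 14 → n ≡ 0 ⊎ n ≡ 7 ⊎ n ≡ 8 ⊎ Obstructed 4 n
sizes<14 = decide-below 14 (λ n → n ≟ 0 ⊎-dec n ≟ 7 ⊎-dec n ≟ 8 ⊎-dec obstructed? 4 n) _

sizes<60 : ∀ n → n < 60 → n ≡ 0 ⊎ n ≡ 33 ⊎ n ≡ 59 ⊎ OneOf sporadic₃ n ⊎ Obstructed 8 n
sizes<60 = decide-below 60
  (λ n → n ≟ 0 ⊎-dec n ≟ 33 ⊎-dec n ≟ 59 ⊎-dec oneOf? sporadic₃ n ⊎-dec obstructed? 8 n) _

sizes₂-realised : ∀ n → (n ≡ 7 ⊎ n ≡ 8) ⊎ 14 ≤ n → DivisibleSet 4 n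
sizes₂-realised _ (inj₁ (inj₁ refl)) = div4-7
sizes₂-realised _ (inj₁ (inj₂ refl)) = div4-8
sizes₂-realised n (inj₂ 14≤n) = sizes≥14 n 14≤n

sizes₂-necessary : ∀ n → 1 ≤ n → ExistsDivSet 2 n → (n ≡ 7 ⊎ n ≡ 8) ⊎ 14 ≤ n
sizes₂-necessary n 1≤n ex with 14 ≤? n
... | yes 14≤n = inj₂ 14≤n
... | no 14≰n = classify (sizes<14 n (≰⇒> 14≰n))
  where
  classify : n ≡ 0 ⊎ n ≡ 7 ⊎ n ≡ 8 ⊎ Obstructed 4 n → (n ≡ 7 ⊎ n ≡ 8) ⊎ 14 ≤ n
  classify (inj₁ n≡0) = ⊥-elim (1+n≰n (subst (1 ≤_) n≡0 1≤n))
  classify (inj₂ (inj₁ n≡7)) = inj₁ (inj₁ n≡7)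
  classify (inj₂ (inj₂ (inj₁ n≡8))) = inj₁ (inj₂ n≡8)
  classify (inj₂ (inj₂ (inj₂ obstructed))) = ⊥-elim (nonexistent 2 (obstructed⇒∄ obstructed) ex)

sizes₃-excluded : ∀ n → 1 ≤ n → n < 60 → n ≢ 59 → ¬ OneOf sporadic₃ n → ¬ ExistsDivSet 3 n
sizes₃-excluded n 1≤n n<60 n≢59 ¬sporadic = excluded (sizes<60 n n<60)
  where
  excluded : n ≡ 0 ⊎ n ≡ 33 ⊎ n ≡ 59 ⊎ OneOf sporadic₃ n ⊎ Obstructed 8 n →
             ¬ ExistsDivSet 3 n
  excluded (inj₁ n≡0) = ⊥-elim (1+n≰n (subst (1 ≤_) n≡0 1≤n))
  excluded (inj₂ (inj₁ n≡33)) = nonexistent 3 (subst (¬_ ∘ DivisibleSet 8) (sym n≡33) ∄-8-33)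
  excluded (inj₂ (inj₂ (inj₁ n≡59))) = ⊥-elim (n≢59 n≡59)
  excluded (inj₂ (inj₂ (inj₂ (inj₁ sporadic)))) = ⊥-elim (¬sporadic sporadic)
  excluded (inj₂ (inj₂ (inj₂ (inj₂ obstructed)))) = nonexistent 3 (obstructed⇒∄ obstructed)

IsF2-3⇒58⊎59 : (m : ℕ) → IsF2 3 m → m ≡ 58 ⊎ m ≡ 59
IsF2-3⇒58⊎59 m isF2 =
  let 58≤m , m≤59 = isF2-between 3 isF2 (nonexistent 3 (excluded-by-moments 8 58 _)) (s≤s z≤n)
                                       (λ n → exists 3 ∘ sizes≥60 n)
  in a≤m≤1+a⇒m≡a⊎m≡1+a 58≤m m≤59

theorem13 :
    -- (i)
    (((n : ℕ) → 3 ≤ n → ExistsDivSet 1 n)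
      × ¬ ExistsDivSet 1 1 × ¬ ExistsDivSet 1 2
      × IsF2 1 2)
    -- (ii)
    × (((n : ℕ) → 1 ≤ n →
          (ExistsDivSet 2 n → (n ≡ 7 ⊎ n ≡ 8) ⊎ 14 ≤ n)
          × ((n ≡ 7 ⊎ n ≡ 8) ⊎ 14 ≤ n → ExistsDivSet 2 n))
      × IsF2 2 13)
    -- (iii)
    × (((n : ℕ) →
          (n ≡ 15 ⊎ n ≡ 16 ⊎ n ≡ 30 ⊎ n ≡ 31 ⊎ n ≡ 32 ⊎ n ≡ 45 ⊎ n ≡ 46
            ⊎ n ≡ 47 ⊎ n ≡ 48 ⊎ n ≡ 49 ⊎ n ≡ 50 ⊎ n ≡ 51 ⊎ 60 ≤ n)
          → ExistsDivSet 3 n)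
      × ((n : ℕ) → 1 ≤ n → n < 60 → n ≢ 59
          → ¬ (n ≡ 15 ⊎ n ≡ 16 ⊎ n ≡ 30 ⊎ n ≡ 31 ⊎ n ≡ 32 ⊎ n ≡ 45 ⊎ n ≡ 46
                ⊎ n ≡ 47 ⊎ n ≡ 48 ⊎ n ≡ 49 ⊎ n ≡ 50 ⊎ n ≡ 51)
          → ¬ ExistsDivSet 3 n)
      × ((m : ℕ) → IsF2 3 m → m ≡ 58 ⊎ m ≡ 59))
theorem13 =
  ( (λ n → exists 1 ∘ sizes≥3 n)
  , nonexistent 1 (excluded-by-moments 2 1 _)
  , nonexistent 1 (excluded-by-moments 2 2 _)
  , isF2-intro 1 2 (s≤s z≤n) (λ n → exists 1 ∘ sizes≥3 n) (nonexistent 1 (excluded-by-moments 2 2 _)) )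
  , ( (λ n 1≤n → sizes₂-necessary n 1≤n , exists 2 ∘ sizes₂-realised n)
    , isF2-intro 2 13 (s≤s z≤n) (λ n → exists 2 ∘ sizes≥14 n) (nonexistent 2 (excluded-by-moments 4 13 _)) )
  , ( (λ n → exists 3 ∘ anyOf-elim sporadic₃ n sporadic₃-sets (sizes≥60 n))
    , sizes₃-excluded
    , IsF2-3⇒58⊎59 )
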